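{- Let $p$ be any pattern in the symmetry class of $(12,\emptyset,\{0,1\})$ or of $(12,\emptyset,\{0,2\})$. Then for all $n\ge 2$, $a_n(p)=n!/2$.
   Context: A bi-vincular pattern of length $k$ is a triple $p=(\sigma,X,Y)$ with $\sigma$ a permutation of $[k]$ in one-line notation and $X,Y\subseteq\{0,1,\dots,k\}$. A permutation $\pi=\pi_1\cdots\pi_n$ of $[n]$ contains $p$ if there are indices $1\le i_1<\dots<i_k\le n$ such that $(\pi_{i_1},\dots,\pi_{i_k})$ is order-isomorphic to $\sigma$ and, writing $j_1<\dots<j_k$ for the set $\{\pi_{i_1},\dots,\pi_{i_k}\}$ in increasing order and setting $i_0=j_0=0$, $i_{k+1}=j_{k+1}=n+1$, we have $i_{x+1}=i_x+1$ for all $x\in X$ and $j_{y+1}=j_y+1$ for all $y\in Y$. Otherwise $\pi$ avoids $p$; $a_n(p)$ is the number of permutations of $[n]$ avoiding $p$. For $p=(\sigma,X,Y)$ of length $k$ define $p^{i}=(\sigma^{ -1},Y,X)$, $p^{r}=(\sigma^{r},\{k-x:x\in X\},Y)$, $p^{c}=(\sigma^{c},X,\{k-y:y\in Y\})$, with $\sigma^r_m=\sigma_{k+1-m}$ and $\sigma^c_m=k+1-\sigma_m$; the symmetry class of $p$ is the set of patterns obtained from $p$ by finite compositions of $i,r,c$. -}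

module Defs where

open import Data.Nat using (ℕ; zero; suc; _+_; _∸_; _<ᵇ_; _≡ᵇ_)
open import Data.Bool using (Bool; true; false; _∧_; _∨_; not; if_then_else_)
open import Data.List using (List; []; _∷_; _++_; [_]; map; filter; length; upTo; concatMap)
open import Data.Bool.ListAction using (all; any)
open import Data.Bool.Properties using (T?)

-- Conventions: a permutation of [n] is a list of naturals (one-line notation,
-- values 1..n).  Positions in the paper are 1-based; `nth` below is 0-based.

-- 0-based list lookup (default 0 out of range)
nth : List ℕ → ℕ → ℕ
nth []       _       = 0
nth (x ∷ xs) zero    = x
nth (x ∷ xs) (suc i) = nth xs i

range : ℕ → ℕ → List ℕ
range a zero    = []
range a (suc m) = a ∷ range (suc a) m

oneTo : ℕ → List ℕ
oneTo n = range 1 n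

elem : ℕ → List ℕ → Bool
elem m xs = any (λ x → m ≡ᵇ x) xs

allLists : ℕ → List ℕ → List (List ℕ)
allLists zero    xs = [ [] ]
allLists (suc l) xs = concatMap (λ x → map (x ∷_) (allLists l xs)) xs

IsPermOfᵇ : ℕ → List ℕ → Bool
IsPermOfᵇ n π = (length π ≡ᵇ n) ∧ all (λ v → elem v (oneTo n)) π ∧ all (λ m → elem m π) (oneTo n)

perms : ℕ → List (List ℕ)
perms n = filter (λ π → T? (IsPermOfᵇ n π)) (allLists n (oneTo n))

-- k-element subsequences of a list (order preserved); applied to positions
-- [1..n] this lists all index tuples i₁ < ... < i_k.
subs : ℕ → List ℕ → List (List ℕ)
subs zero    _        = [ [] ]
subs (suc k) []       = []
subs (suc k) (x ∷ xs) = map (x ∷_) (subs k xs) ++ subs (suc k) xs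

insert : ℕ → List ℕ → List ℕ
insert x []       = [ x ]
insert x (y ∷ ys) = if x <ᵇ y then x ∷ y ∷ ys else y ∷ insert x ys

sort : List ℕ → List ℕ
sort []       = []
sort (x ∷ xs) = insert x (sort xs)

-- bi-vincular pattern (σ, X, Y); its length k is the length of σ
record Pattern : Set where
  constructor pat
  field
    σ : List ℕ
    X : List ℕ
    Y : List ℕ
open Pattern public

orderIsoᵇ : ℕ → List ℕ → List ℕ → Bool
orderIsoᵇ k us vs =
  all (λ a → all (λ b → (nth us a <ᵇ nth us b) ≡ᵇB (nth vs a <ᵇ nth vs b)) (range 0 k)) (range 0 k)
  where
  _≡ᵇB_ : Bool → Bool → Bool
  true  ≡ᵇB b = b
  false ≡ᵇB b = not b

-- adjacency requirement: for all x ∈ Z, e_{x+1} = e_x + 1, where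
-- e = (e₀, e₁, ..., e_{k+1}) = (0, t₁, ..., t_k, n+1)
adjᵇ : ℕ → List ℕ → List ℕ → Bool
adjᵇ n Z ts = all (λ x → nth e (suc x) ≡ᵇ suc (nth e x)) Z
  where
  e : List ℕ
  e = 0 ∷ ts ++ [ suc n ]

occurrenceᵇ : Pattern → ℕ → List ℕ → List ℕ → Bool
occurrenceᵇ p n π is =
  orderIsoᵇ (length (σ p)) vals (σ p) ∧ adjᵇ n (X p) is ∧ adjᵇ n (Y p) (sort vals)
  where
  vals : List ℕ
  vals = map (λ i → nth π (i ∸ 1)) is

containsᵇ : Pattern → List ℕ → Bool
containsᵇ p π = any (occurrenceᵇ p (length π) π) (subs (length (σ p)) (oneTo (length π)))

a : ℕ → Pattern → ℕ
a n p = length (filter (λ π → T? (not (containsᵇ p π))) (perms n))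

-- symmetries
-- position (1-based) of m in a list (0 if absent)
posOf : ℕ → List ℕ → ℕ
posOf m []       = 0
posOf m (x ∷ xs) = if m ≡ᵇ x then 1 else (if elem m xs then suc (posOf m xs) else 0)

reverse' : List ℕ → List ℕ
reverse' []       = []
reverse' (x ∷ xs) = reverse' xs ++ [ x ]

invPerm : List ℕ → List ℕ
invPerm s = map (λ m → posOf m s) (oneTo (length s))

compPerm : List ℕ → List ℕ
compPerm s = map (λ v → suc (length s) ∸ v) s

symI : Pattern → Pattern
symI (pat s x y) = pat (invPerm s) y x

symR : Pattern → Pattern
symR (pat s x y) = pat (reverse' s) (map (λ t → length s ∸ t) x) y

symC : Pattern → Pattern
symC (pat s x y) = pat (compPerm s) x (map (λ t → length s ∸ t) y)

data InClass (p : Pattern) : Pattern → Set where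
  base : InClass p p
  viaI : ∀ {q} → InClass p q → InClass p (symI q)
  viaR : ∀ {q} → InClass p q → InClass p (symR q)
  viaC : ∀ {q} → InClass p q → InClass p (symC q)

module Submission where

-- Each class consists of the value patterns (σ, ∅, Z) and the position
-- patterns (σ, Z, ∅) with σ ∈ {12, 21} and Z ∈ {{0,1}, {1,2}}, resp. Z = {0,2}.
-- The adjacency set Z pins down a pair of entries α+1 < β+1 (two positions,
-- resp. two values), so π contains p iff these two entries appear in the
-- order of σ.  Exchanging them is an involution of S_n which toggles
-- containment, so exactly half of the n! permutations avoid p.

open import Defs
open import Data.Nat using (ℕ; zero; suc; _+_; _*_; _≤_; _<_; _/_; _!; z≤n; s≤s; _<ᵇ_; _≡ᵇ_; pred)
open import Relation.Binary.PropositionalEquality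
open import Data.Nat.Properties
open import Data.Nat.DivMod using (m*n/n≡m)
open import Data.Nat.ListAction using (sum)
open import Data.List using (List; []; _∷_; _++_; map; filter; length; concatMap)
open import Data.List.Properties
  using (length-map; length-++; filter-++; filter-notAll; ∷-injectiveʳ; map-∘; map-cong; map-id; ≡-dec)
open import Data.Bool using (Bool; true; false; _∧_; not; if_then_else_; T)
open import Data.Bool.Properties using (T?)
open import Data.Bool.ListAction using (all)
open import Data.List.Membership.Propositional using (_∈_; _∉_; find; lose)
open import Data.List.Membership.Propositional.Properties
  using ( ∈-map⁺; ∈-map⁻; ∈-filter⁻; ∈-filter⁺; ∈-++⁺ˡ; ∈-++⁺ʳ; ∈-++⁻; ∈-concatMap⁺; ∈-concatMap⁻
        ; map∷⁻; map∷-decomp∈)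
open import Data.List.Membership.DecPropositional _≟_ using (_∈?_)
open import Data.List.Membership.Propositional.Properties.WithK using (unique∧set⇒bag)
open import Data.List.Relation.Binary.Subset.Propositional using (_⊆_)
open import Data.List.Relation.Binary.Disjoint.Propositional using (Disjoint)
open import Data.List.Relation.Binary.BagAndSetEquality using (∼bag⇒↭)
open import Data.List.Relation.Binary.Permutation.Propositional using (_↭_; ↭-sym)
open import Data.List.Relation.Binary.Permutation.Propositional.Properties using (↭-length; filter-↭)
open import Data.List.Relation.Unary.Any as Any using (Any; here; there)
open import Data.List.Relation.Unary.Any.Properties using (any⁺; any⁻)
open import Data.List.Relation.Unary.All as All using (All; all?; lookup; []; _∷_)
open import Data.List.Relation.Unary.All.Properties using (all⁺; all⁻; ¬Any⇒All¬; All¬⇒¬Any)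
open import Data.List.Relation.Unary.AllPairs as AllPairs using ([]; _∷_)
import Data.List.Relation.Unary.AllPairs.Properties as AllPairs
open import Data.List.Relation.Unary.Unique.Propositional using (Unique)
import Data.List.Relation.Unary.Unique.Propositional.Properties as Unique
open import Data.Product using (∃; ∃₂; _×_; _,_; proj₁; proj₂)
open import Data.Sum using (_⊎_; inj₁; inj₂)
open import Data.Empty using (⊥; ⊥-elim)
open import Data.Unit using (tt)
open import Function using (_∘_; id; mk⇔)
open import Relation.Nullary using (¬_; Dec; yes; no)
open import Relation.Nullary.Decidable using (toWitness)

elem⇒∈ : ∀ {m} xs → T (elem m xs) → m ∈ xs
elem⇒∈ xs t = Any.map (λ {x} → ≡ᵇ⇒≡ _ x) (any⁻ _ xs t)

∈⇒elem : ∀ {m xs} → m ∈ xs → T (elem m xs)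
∈⇒elem {m} m∈ = any⁺ _ (Any.map (λ { refl → ≡⇒≡ᵇ m m refl }) m∈)

T-ext : ∀ {b c : Bool} → (T b → T c) → (T c → T b) → b ≡ c
T-ext {true}  {true}  f g = refl
T-ext {true}  {false} f g = ⊥-elim (f tt)
T-ext {false} {true}  f g = ⊥-elim (g tt)
T-ext {false} {false} f g = refl

T-≡ : ∀ {b} → T b → b ≡ true
T-≡ {true} _ = refl

T-∧⁻ : ∀ b {c} → T (b ∧ c) → T b × T c
T-∧⁻ true t = tt , t

T-∧⁺ : ∀ {b c} → T b → T c → T (b ∧ c)
T-∧⁺ {true} _ t = t

<ᵇ-flip : ∀ x y → x ≢ y → (y <ᵇ x) ≡ not (x <ᵇ y)
<ᵇ-flip x y x≢y = T-ext to from
  where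
  to : T (y <ᵇ x) → T (not (x <ᵇ y))
  to t with x <ᵇ y in eq
  ... | true  = <-asym (<ᵇ⇒< x y (subst T (sym eq) tt)) (<ᵇ⇒< y x t)
  ... | false = tt
  from : T (not (x <ᵇ y)) → T (y <ᵇ x)
  from t with x <ᵇ y in eq
  ... | false = <⇒<ᵇ (≤∧≢⇒< (≮⇒≥ (λ x<y → subst T eq (<⇒<ᵇ x<y))) (x≢y ∘ sym))

≢⇒≡ᵇ-false : ∀ {x y} → x ≢ y → (x ≡ᵇ y) ≡ false
≢⇒≡ᵇ-false {x} {y} x≢y with x ≡ᵇ y in eq
... | true  = ⊥-elim (x≢y (≡ᵇ⇒≡ x y (subst T (sym eq) tt)))
... | false = refl

≡ᵇ-T : ∀ m → T (m ≡ᵇ m)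
≡ᵇ-T m = ≡⇒≡ᵇ m m refl

≡ᵇ-refl : ∀ m → (m ≡ᵇ m) ≡ true
≡ᵇ-refl m = T-≡ (≡ᵇ-T m)

<ᵇ-irrefl : ∀ x → (x <ᵇ x) ≡ false
<ᵇ-irrefl x = T-ext (λ t → <-irrefl refl (<ᵇ⇒< x x t)) λ ()

<ᵇ-asym : ∀ {x y} → (x <ᵇ y) ≡ true → (y <ᵇ x) ≡ true → ⊥
<ᵇ-asym {x} {y} x<y y<x = <-asym (<ᵇ⇒< x y (subst T (sym x<y) tt)) (<ᵇ⇒< y x (subst T (sym y<x) tt))

unique-∷ : ∀ {A : Set} {x : A} {xs} → x ∉ xs → Unique xs → Unique (x ∷ xs)
unique-∷ {xs = xs} x∉ xs! = ¬Any⇒All¬ xs x∉ ∷ xs!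

map-unique : ∀ {A B : Set} (φ : A → B) {xs} → (∀ {x y} → x ∈ xs → y ∈ xs → φ x ≡ φ y → x ≡ y) →
  Unique xs → Unique (map φ xs)
map-unique φ inj [] = []
map-unique φ {x ∷ xs} inj (x≢ ∷ xs!) =
  unique-∷ φx∉ (map-unique φ (λ x∈ y∈ → inj (there x∈) (there y∈)) xs!)
  where
  φx∉ : φ x ∉ map φ xs
  φx∉ φx∈ with ∈-map⁻ φ φx∈
  ... | y , y∈ , e = All¬⇒¬Any x≢ (subst (_∈ xs) (sym (inj (here refl) (there y∈) e)) y∈)

without : ℕ → List ℕ → List ℕ
without x = filter (λ y → T? (not (x ≡ᵇ y)))

∈-without⁻ : ∀ {x v} ys → v ∈ without x ys → v ∈ ys × x ≢ v
∈-without⁻ {x} ys v∈ with ∈-filter⁻ (λ y → T? (not (x ≡ᵇ y))) {xs = ys} v∈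
... | v∈ys , kept = v∈ys , λ { refl → subst (T ∘ not) (≡ᵇ-refl x) kept }

∈-without⁺ : ∀ {x v ys} → v ∈ ys → x ≢ v → v ∈ without x ys
∈-without⁺ {x} v∈ x≢v =
  ∈-filter⁺ (λ y → T? (not (x ≡ᵇ y))) v∈ (subst (T ∘ not) (sym (≢⇒≡ᵇ-false x≢v)) tt)

without-∉ : ∀ {x} ys → x ∉ ys → without x ys ≡ ys
without-∉ []           _   = refl
without-∉ {x} (y ∷ ys) x∉ rewrite ≢⇒≡ᵇ-false {x} {y} (x∉ ∘ here) =
  cong (y ∷_) (without-∉ ys (x∉ ∘ there))

length-without : ∀ {x} ys → x ∈ ys → Unique ys → length (without x ys) ≡ pred (length ys)
length-without {x} (y ∷ ys) x∈ (y≢ ∷ ys!) with x ≟ y | x∈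
... | yes refl | _          rewrite ≡ᵇ-refl x = cong length (without-∉ ys (All¬⇒¬Any y≢))
... | no x≢y   | here x≡y   = ⊥-elim (x≢y x≡y)
... | no x≢y   | there x∈ys rewrite ≢⇒≡ᵇ-false x≢y =
  trans (cong suc (length-without ys x∈ys ys!)) (suc-pred-length x∈ys)
  where
  suc-pred-length : ∀ {zs : List ℕ} → x ∈ zs → suc (pred (length zs)) ≡ length zs
  suc-pred-length (here _)  = refl
  suc-pred-length (there _) = refl

unique-⊆-length : ∀ {ys zs : List ℕ} → Unique ys → ys ⊆ zs → length ys ≤ length zs
unique-⊆-length {[]}          _          _     = z≤n
unique-⊆-length {y ∷ ys} {zs} (y≢ ∷ ys!) ys⊆zs =
  ≤-<-trans (unique-⊆-length ys! ys⊆zs∖y) (filter-notAll (λ z → T? (not (y ≡ᵇ z))) zs y-rejected)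
  where
  ys⊆zs∖y : ys ⊆ without y zs
  ys⊆zs∖y v∈ = ∈-without⁺ {y} (ys⊆zs (there v∈)) (λ { refl → All¬⇒¬Any y≢ v∈ })
  y-rejected : Any (λ z → ¬ T (not (y ≡ᵇ z))) zs
  y-rejected = Any.map (λ { refl → subst (T ∘ not) (≡ᵇ-refl y) }) (ys⊆zs (here refl))

covering-unique : ∀ {ys l : List ℕ} → Unique ys → ys ⊆ l → length l ≤ length ys → Unique l
covering-unique {ys} {[]}    _   _     _  = []
covering-unique {ys} {z ∷ l} ys! ys⊆zl le =
  unique-∷ z∉l (covering-unique (Unique.filter⁺ _ ys!) rest⊆l rest-long-enough)
  where
  l-too-short : ¬ (ys ⊆ l)
  l-too-short ys⊆l = <-irrefl refl (≤-trans le (unique-⊆-length ys! ys⊆l))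
  covered-by-l : ∀ {v} → v ∈ ys → z ≢ v → v ∈ l
  covered-by-l v∈ z≢v with ys⊆zl v∈
  ... | here v≡z = ⊥-elim (z≢v (sym v≡z))
  ... | there v∈l = v∈l
  z∈ys : z ∈ ys
  z∈ys with z ∈? ys
  ... | yes z∈ = z∈
  ... | no z∉  = ⊥-elim (l-too-short (λ v∈ → covered-by-l v∈ (λ { refl → z∉ v∈ })))
  z∉l : z ∉ l
  z∉l z∈l = l-too-short covered
    where
    covered : ys ⊆ l
    covered {v} v∈ with z ≟ v
    ... | yes refl = z∈l
    ... | no z≢v   = covered-by-l v∈ z≢v
  rest⊆l : without z ys ⊆ l
  rest⊆l v∈ = let (v∈ys , z≢v) = ∈-without⁻ ys v∈ in covered-by-l v∈ys z≢v
  rest-long-enough : length l ≤ length (without z ys)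
  rest-long-enough = subst (length l ≤_) (sym (length-without ys z∈ys ys!)) (pred-mono-≤ le)

-- Number of elements of a list satisfying a boolean test.  With this
-- definition  a n p  is literally  count (not ∘ containsᵇ p) (perms n).
count : {A : Set} → (A → Bool) → List A → ℕ
count f xs = length (filter (λ x → T? (f x)) xs)

count-complement : ∀ {A : Set} (f : A → Bool) xs → count f xs + count (not ∘ f) xs ≡ length xs
count-complement f [] = refl
count-complement f (x ∷ xs) with f x
... | true  = cong suc (count-complement f xs)
... | false = trans (+-suc (count f xs) _) (cong suc (count-complement f xs))

count-cong : ∀ {A : Set} (f g : A → Bool) xs → (∀ x → x ∈ xs → f x ≡ g x) → count f xs ≡ count g xs
count-cong f g [] h = refl
count-cong f g (x ∷ xs) h with f x | g x | h x (here refl)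
... | true  | true  | _ = cong suc (count-cong f g xs (λ y y∈ → h y (there y∈)))
... | false | false | _ = count-cong f g xs (λ y y∈ → h y (there y∈))

count-map : ∀ {A B : Set} (f : B → Bool) (h : A → B) xs → count f (map h xs) ≡ count (f ∘ h) xs
count-map f h [] = refl
count-map f h (x ∷ xs) with f (h x)
... | true  = cong suc (count-map f h xs)
... | false = count-map f h xs

count-↭ : ∀ {A : Set} (f : A → Bool) {xs ys} → xs ↭ ys → count f xs ≡ count f ys
count-↭ f xs↭ys = ↭-length (filter-↭ (λ x → T? (f x)) xs↭ys)

count-concatMap : ∀ {A B : Set} (f : B → Bool) (h : A → List B) xs →
  count f (concatMap h xs) ≡ sum (map (count f ∘ h) xs)
count-concatMap f h [] = refl
count-concatMap f h (x ∷ xs) = begin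
  count f (h x ++ concatMap h xs)
    ≡⟨ cong length (filter-++ (λ y → T? (f y)) (h x) (concatMap h xs)) ⟩
  length (filter _ (h x) ++ filter _ (concatMap h xs))
    ≡⟨ length-++ (filter (λ y → T? (f y)) (h x)) ⟩
  count f (h x) + count f (concatMap h xs)
    ≡⟨ cong (count f (h x) +_) (count-concatMap f h xs) ⟩
  count f (h x) + sum (map (count f ∘ h) xs) ∎
  where open ≡-Reasoning

sum-const : ∀ {A : Set} (g : A → ℕ) c xs → (∀ x → x ∈ xs → g x ≡ c) → sum (map g xs) ≡ length xs * c
sum-const g c [] h = refl
sum-const g c (x ∷ xs) h = cong₂ _+_ (h x (here refl)) (sum-const g c xs (λ y y∈ → h y (there y∈)))

count-false : ∀ {A : Set} (xs : List A) → count (λ _ → false) xs ≡ 0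
count-false []       = refl
count-false (_ ∷ xs) = count-false xs

sum-skip : ∀ x (g h : ℕ → ℕ) xs → g x ≡ 0 → (∀ y → x ≢ y → g y ≡ h y) →
  sum (map g xs) ≡ sum (map h (without x xs))
sum-skip x g h []       _     _     = refl
sum-skip x g h (y ∷ xs) gx≡0 g≡h with x ≟ y
... | yes refl rewrite ≡ᵇ-refl x = trans (cong (_+ sum (map g xs)) gx≡0) (sum-skip x g h xs gx≡0 g≡h)
... | no x≢y rewrite ≢⇒≡ᵇ-false x≢y = cong₂ _+_ (g≡h y x≢y) (sum-skip x g h xs gx≡0 g≡h)

-- An involution φ of a duplicate-free list xs merely permutes it, hence
-- counting f over xs is the same as counting  f ∘ φ.
count-involution : ∀ {A : Set} (f : A → Bool) (φ : A → A) xs → Unique xs →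
  (∀ x → x ∈ xs → φ x ∈ xs) → (∀ x → x ∈ xs → φ (φ x) ≡ x) →
  count f xs ≡ count (f ∘ φ) xs
count-involution f φ xs xs! closed invol = trans (count-↭ f (↭-sym image↭)) (count-map f φ xs)
  where
  φ-injective : ∀ {x y} → x ∈ xs → y ∈ xs → φ x ≡ φ y → x ≡ y
  φ-injective x∈ y∈ e = trans (sym (invol _ x∈)) (trans (cong φ e) (invol _ y∈))
  image! : Unique (map φ xs)
  image! = map-unique φ φ-injective xs!
  image↭ : map φ xs ↭ xs
  image↭ = ∼bag⇒↭ (unique∧set⇒bag image! xs! (mk⇔ to from))
    where
    to : ∀ {x} → x ∈ map φ xs → x ∈ xs
    to x∈ with ∈-map⁻ φ x∈
    ... | y , y∈ , refl = closed y y∈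
    from : ∀ {x} → x ∈ xs → x ∈ map φ xs
    from {x} x∈ = subst (_∈ map φ xs) (invol x x∈) (∈-map⁺ φ (closed x x∈))

∈-range⁻ : ∀ a m {v} → v ∈ range a m → a ≤ v × v < a + m
∈-range⁻ a (suc m) (here refl) = ≤-refl , m<m+n a (s≤s z≤n)
∈-range⁻ a (suc m) {v} (there v∈) with ∈-range⁻ (suc a) m v∈
... | a<v , v<sa+m = <⇒≤ a<v , subst (v <_) (sym (+-suc a m)) v<sa+m

∈-range⁺ : ∀ a m {v} → a ≤ v → v < a + m → v ∈ range a m
∈-range⁺ a zero    {v} a≤v v<a+0 = ⊥-elim (<-irrefl refl (<-≤-trans (subst (v <_) (+-identityʳ a) v<a+0) a≤v))
∈-range⁺ a (suc m) {v} a≤v v<a+m with a ≟ v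
... | yes refl = here refl
... | no a≢v   = there (∈-range⁺ (suc a) m (≤∧≢⇒< a≤v a≢v) (subst (v <_) (+-suc a m) v<a+m))

unique-range : ∀ a m → Unique (range a m)
unique-range a zero    = []
unique-range a (suc m) =
  unique-∷ (λ a∈ → <-irrefl refl (proj₁ (∈-range⁻ (suc a) m a∈))) (unique-range (suc a) m)

length-range : ∀ a m → length (range a m) ≡ m
length-range a zero    = refl
length-range a (suc m) = cong suc (length-range (suc a) m)

nth-map-range : ∀ (f : ℕ → ℕ) a m {k} → k < m → nth (map f (range a m)) k ≡ f (a + k)
nth-map-range f a (suc m) {zero}  _       = cong f (sym (+-identityʳ a))
nth-map-range f a (suc m) {suc k} (s≤s k<m) =
  trans (nth-map-range f (suc a) m k<m) (cong f (sym (+-suc a k)))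

∈-oneTo⁺ : ∀ n {v} → 1 ≤ v → v ≤ n → v ∈ oneTo n
∈-oneTo⁺ n 1≤v v≤n = ∈-range⁺ 1 n 1≤v (s≤s v≤n)

∈-allLists⁻ : ∀ k xs {l} → l ∈ allLists k xs → length l ≡ k × l ⊆ xs
∈-allLists⁻ zero    xs (here refl) = refl , λ ()
∈-allLists⁻ (suc k) xs l∈ with find (∈-concatMap⁻ (λ x → map (x ∷_) (allLists k xs)) {xs = xs} l∈)
... | x , x∈ , l∈x with map∷⁻ l∈x
... | l' , l'∈ , refl with ∈-allLists⁻ k xs l'∈
... | len , l'⊆ = cong suc len , λ { (here refl) → x∈ ; (there v∈) → l'⊆ v∈ }

∈-allLists⁺ : ∀ k xs {l} → length l ≡ k → l ⊆ xs → l ∈ allLists k xs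
∈-allLists⁺ zero    xs {[]}    _   _    = here refl
∈-allLists⁺ (suc k) xs {x ∷ l} len x∷l⊆ =
  ∈-concatMap⁺ (λ y → map (y ∷_) (allLists k xs))
    (lose (x∷l⊆ (here refl)) (∈-map⁺ (x ∷_) (∈-allLists⁺ k xs (suc-injective len) (x∷l⊆ ∘ there))))

-- Words over a duplicate-free alphabet are listed without repetition:
-- blocks with different first letters are disjoint.
unique-allLists : ∀ k {xs} → Unique xs → Unique (allLists k xs)
unique-allLists zero    _   = [] ∷ []
unique-allLists (suc k) {xs} xs! =
  Unique.concat⁺ (All.tabulate block-unique) (AllPairs.map⁺ (AllPairs.map blocks-disjoint xs!))
  where
  words! : Unique (allLists k xs)
  words! = unique-allLists k xs!
  block-unique : ∀ {b} → b ∈ map (λ x → map (x ∷_) (allLists k xs)) xs → Unique b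
  block-unique b∈ with ∈-map⁻ _ b∈
  ... | x , _ , refl = Unique.map⁺ ∷-injectiveʳ words!
  blocks-disjoint : ∀ {x y} → x ≢ y →
    Disjoint (map (x ∷_) (allLists k xs)) (map (y ∷_) (allLists k xs))
  blocks-disjoint x≢y (w∈x , w∈y) with map∷⁻ w∈x
  ... | _ , _ , refl = x≢y (proj₁ (map∷-decomp∈ w∈y))

count-avoiding : ∀ k x (Q : List ℕ → Bool) xs →
  count (λ l → not (elem x l) ∧ Q l) (allLists k xs) ≡ count Q (allLists k (without x xs))
count-avoiding zero    x Q xs with Q []
... | true  = refl
... | false = refl
count-avoiding (suc k) x Q xs = begin
  count avoidsQ (concatMap (block xs) xs)         ≡⟨ count-concatMap avoidsQ (block xs) xs ⟩
  sum (map (count avoidsQ ∘ block xs) xs)         ≡⟨ sum-skip x _ _ xs starting-with-x starting-elsewhere ⟩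
  sum (map (count Q ∘ block xs∖x) xs∖x)           ≡⟨ sym (count-concatMap Q (block xs∖x) xs∖x) ⟩
  count Q (allLists (suc k) xs∖x)                 ∎
  where
  open ≡-Reasoning
  xs∖x : List ℕ
  xs∖x = without x xs
  avoidsQ : List ℕ → Bool
  avoidsQ l = not (elem x l) ∧ Q l
  block : List ℕ → ℕ → List (List ℕ)
  block ys y = map (y ∷_) (allLists k ys)
  starting-with-x : count avoidsQ (block xs x) ≡ 0
  starting-with-x = begin
    count avoidsQ (block xs x)                ≡⟨ count-map avoidsQ (x ∷_) (allLists k xs) ⟩
    count (avoidsQ ∘ (x ∷_)) (allLists k xs)  ≡⟨ count-cong _ _ (allLists k xs) (λ l _ → repeats-x l) ⟩
    count (λ _ → false) (allLists k xs)       ≡⟨ count-false (allLists k xs) ⟩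
    0                                         ∎
    where
    repeats-x : ∀ l → avoidsQ (x ∷ l) ≡ false
    repeats-x l rewrite ≡ᵇ-refl x = refl
  starting-elsewhere : ∀ y → x ≢ y → count avoidsQ (block xs y) ≡ count Q (block xs∖x y)
  starting-elsewhere y x≢y = begin
    count avoidsQ (block xs y)
      ≡⟨ count-map avoidsQ (y ∷_) (allLists k xs) ⟩
    count (avoidsQ ∘ (y ∷_)) (allLists k xs)
      ≡⟨ count-cong _ _ (allLists k xs) (λ l _ → drop-y l) ⟩
    count (λ l → not (elem x l) ∧ Q (y ∷ l)) (allLists k xs)
      ≡⟨ count-avoiding k x (Q ∘ (y ∷_)) xs ⟩
    count (Q ∘ (y ∷_)) (allLists k xs∖x)
      ≡⟨ sym (count-map Q (y ∷_) (allLists k xs∖x)) ⟩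
    count Q (block xs∖x y)
      ∎
    where
    drop-y : ∀ l → avoidsQ (y ∷ l) ≡ not (elem x l) ∧ Q (y ∷ l)
    drop-y l rewrite ≢⇒≡ᵇ-false x≢y = refl

injᵇ : List ℕ → Bool
injᵇ []       = true
injᵇ (x ∷ xs) = not (elem x xs) ∧ injᵇ xs

falling : ℕ → ℕ → ℕ
falling m zero    = 1
falling m (suc k) = m * falling (pred m) k

falling-n-n : ∀ n → falling n n ≡ n !
falling-n-n zero    = refl
falling-n-n (suc n) = cong (suc n *_) (falling-n-n n)

count-injective : ∀ k xs → Unique xs → count injᵇ (allLists k xs) ≡ falling (length xs) k
count-injective zero    xs _   = refl
count-injective (suc k) xs xs! = begin
  count injᵇ (concatMap block xs)                 ≡⟨ count-concatMap injᵇ block xs ⟩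
  sum (map (count injᵇ ∘ block) xs)               ≡⟨ sum-const _ _ xs starting-with ⟩
  length xs * falling (pred (length xs)) k        ∎
  where
  open ≡-Reasoning
  block : ℕ → List (List ℕ)
  block y = map (y ∷_) (allLists k xs)
  starting-with : ∀ y → y ∈ xs → count injᵇ (block y) ≡ falling (pred (length xs)) k
  starting-with y y∈ = begin
    count injᵇ (block y)
      ≡⟨ count-map injᵇ (y ∷_) (allLists k xs) ⟩
    count (λ l → not (elem y l) ∧ injᵇ l) (allLists k xs)
      ≡⟨ count-avoiding k y injᵇ xs ⟩
    count injᵇ (allLists k (without y xs))
      ≡⟨ count-injective k (without y xs) (Unique.filter⁺ _ xs!) ⟩
    falling (length (without y xs)) k
      ≡⟨ cong (λ m → falling m k) (length-without xs y∈ xs!) ⟩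
    falling (pred (length xs)) k
      ∎

isPerm⇒ : ∀ n π → T (IsPermOfᵇ n π) → length π ≡ n × π ⊆ oneTo n × oneTo n ⊆ π
isPerm⇒ n π t with T-∧⁻ (length π ≡ᵇ n) t
... | len , t′ with T-∧⁻ (all (λ v → elem v (oneTo n)) π) t′
... | into , onto =
  ≡ᵇ⇒≡ _ _ len ,
  (λ v∈ → elem⇒∈ (oneTo n) (lookup (all⁺ _ π into) v∈)) ,
  (λ m∈ → elem⇒∈ π (lookup (all⁺ _ (oneTo n) onto) m∈))

isPerm⇐ : ∀ n π → length π ≡ n → π ⊆ oneTo n → oneTo n ⊆ π → T (IsPermOfᵇ n π)
isPerm⇐ n π len into onto =
  T-∧⁺ (≡⇒≡ᵇ _ _ len)
    (T-∧⁺ (all⁻ _ (All.tabulate (∈⇒elem ∘ into))) (all⁻ _ (All.tabulate (∈⇒elem ∘ onto))))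

-- A permutation has no repeated entries (it covers [n] with n entries).
perm-unique : ∀ n π → T (IsPermOfᵇ n π) → Unique π
perm-unique n π t with isPerm⇒ n π t
... | len , _ , onto =
  covering-unique (unique-range 1 n) onto (≤-reflexive (trans len (sym (length-range 1 n))))

injᵇ⇒unique : ∀ l → T (injᵇ l) → Unique l
injᵇ⇒unique []      _ = []
injᵇ⇒unique (x ∷ l) t with elem x l in eq
... | false = unique-∷ (λ x∈ → subst T eq (∈⇒elem x∈)) (injᵇ⇒unique l t)

unique⇒injᵇ : ∀ l → Unique l → T (injᵇ l)
unique⇒injᵇ []      _          = tt
unique⇒injᵇ (x ∷ l) (x≢ ∷ l!) with elem x l in eq
... | true  = All¬⇒¬Any x≢ (elem⇒∈ l (subst T (sym eq) tt))
... | false = unique⇒injᵇ l l!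

perm⇔injective : ∀ n l → l ∈ allLists n (oneTo n) → IsPermOfᵇ n l ≡ injᵇ l
perm⇔injective n l l∈ with ∈-allLists⁻ n (oneTo n) l∈
... | len , into =
  T-ext (λ t → unique⇒injᵇ l (perm-unique n l t)) (λ t → isPerm⇐ n l len into (onto (injᵇ⇒unique l t)))
  where
  onto : Unique l → oneTo n ⊆ l
  onto l! {m} m∈ with m ∈? l
  ... | yes m∈l = m∈l
  ... | no m∉l  = ⊥-elim (<-irrefl refl (subst₂ _≤_ (cong suc len) (length-range 1 n) too-long))
    where
    too-long : length (m ∷ l) ≤ length (oneTo n)
    too-long = unique-⊆-length (unique-∷ m∉l l!) λ { (here refl) → m∈ ; (there v∈) → into v∈ }

∈-perms⁻ : ∀ n {π} → π ∈ perms n → T (IsPermOfᵇ n π)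
∈-perms⁻ n π∈ = proj₂ (∈-filter⁻ (λ l → T? (IsPermOfᵇ n l)) {xs = allLists n (oneTo n)} π∈)

∈-perms⁺ : ∀ n {π} → T (IsPermOfᵇ n π) → π ∈ perms n
∈-perms⁺ n {π} t with isPerm⇒ n π t
... | len , into , _ = ∈-filter⁺ (λ l → T? (IsPermOfᵇ n l)) (∈-allLists⁺ n (oneTo n) len into) t

unique-perms : ∀ n → Unique (perms n)
unique-perms n = Unique.filter⁺ _ (unique-allLists n (unique-range 1 n))

length-perms : ∀ n → length (perms n) ≡ n !
length-perms n = begin
  count (IsPermOfᵇ n) words           ≡⟨ count-cong _ _ words (perm⇔injective n) ⟩
  count injᵇ words                    ≡⟨ count-injective n (oneTo n) (unique-range 1 n) ⟩
  falling (length (oneTo n)) n        ≡⟨ cong (λ m → falling m n) (length-range 1 n) ⟩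
  falling n n                         ≡⟨ falling-n-n n ⟩
  n !                                 ∎
  where
  open ≡-Reasoning
  words : List (List ℕ)
  words = allLists n (oneTo n)

-- Halving principle: an involution of S_n which toggles containment of p
-- pairs the avoiders of p with the containers, so exactly half of S_n
-- avoids p.
halving : ∀ (p : Pattern) n (φ : List ℕ → List ℕ) →
  (∀ π → T (IsPermOfᵇ n π) → T (IsPermOfᵇ n (φ π))) →
  (∀ π → T (IsPermOfᵇ n π) → φ (φ π) ≡ π) →
  (∀ π → T (IsPermOfᵇ n π) → containsᵇ p (φ π) ≡ not (containsᵇ p π)) →
  a n p ≡ n ! / 2
halving p n φ closed invol toggles = begin
  a n p          ≡⟨ sym (m*n/n≡m (a n p) 2) ⟩
  a n p * 2 / 2  ≡⟨ cong (_/ 2) twice ⟩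
  n ! / 2        ∎
  where
  open ≡-Reasoning
  C : List ℕ → Bool
  C = containsᵇ p
  S : List (List ℕ)
  S = perms n
  containers≡avoiders : count C S ≡ a n p
  containers≡avoiders = begin
    count C S
      ≡⟨ count-involution C φ S (unique-perms n) (λ π π∈ → ∈-perms⁺ n (closed π (∈-perms⁻ n π∈)))
                                                 (λ π π∈ → invol π (∈-perms⁻ n π∈)) ⟩
    count (C ∘ φ) S
      ≡⟨ count-cong _ _ S (λ π π∈ → toggles π (∈-perms⁻ n π∈)) ⟩
    count (not ∘ C) S
      ∎
  twice : a n p * 2 ≡ n !
  twice = begin
    a n p * 2                      ≡⟨ *-comm (a n p) 2 ⟩
    a n p + (a n p + 0)            ≡⟨ cong (a n p +_) (+-identityʳ (a n p)) ⟩
    a n p + a n p                  ≡⟨ cong (_+ a n p) (sym containers≡avoiders) ⟩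
    count C S + count (not ∘ C) S  ≡⟨ count-complement C S ⟩
    length S                       ≡⟨ length-perms n ⟩
    n !                            ∎

-- The two permutations of length 2:  σ₂ true = 12  and  σ₂ false = 21
-- (written so that its length is visibly 2 for every d).
σ₂ : Bool → List ℕ
σ₂ d = (if d then 1 else 2) ∷ (if d then 2 else 1) ∷ []

ordered : Bool → ℕ → ℕ → Bool
ordered true  x y = x <ᵇ y
ordered false x y = y <ᵇ x

orderIso-σ₂ : ∀ d x y → orderIsoᵇ 2 (x ∷ y ∷ []) (σ₂ d) ≡ ordered d x y
orderIso-σ₂ true x y rewrite <ᵇ-irrefl x | <ᵇ-irrefl y with x <ᵇ y in x<y | y <ᵇ x in y<x
... | true  | true  = ⊥-elim (<ᵇ-asym {x} {y} x<y y<x)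
... | true  | false = refl
... | false | _     = refl
orderIso-σ₂ false x y rewrite <ᵇ-irrefl x | <ᵇ-irrefl y with x <ᵇ y in x<y | y <ᵇ x in y<x
... | true  | true  = ⊥-elim (<ᵇ-asym {x} {y} x<y y<x)
... | false | true  = refl
... | true  | false = refl
... | false | false = refl

ordered-flip : ∀ d x y → x ≢ y → ordered d y x ≡ not (ordered d x y)
ordered-flip true  x y x≢y = <ᵇ-flip x y x≢y
ordered-flip false x y x≢y = <ᵇ-flip y x (x≢y ∘ sym)

∈-subs₁⁻ : ∀ (xs : List ℕ) {l} → l ∈ subs 1 xs → ∃ λ v → l ≡ v ∷ [] × v ∈ xs
∈-subs₁⁻ (x ∷ xs) (here refl) = x , refl , here refl
∈-subs₁⁻ (x ∷ xs) (there l∈) with ∈-subs₁⁻ xs l∈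
... | v , refl , v∈ = v , refl , there v∈

∈-subs₁⁺ : ∀ {xs : List ℕ} {v} → v ∈ xs → (v ∷ []) ∈ subs 1 xs
∈-subs₁⁺ (here refl) = here refl
∈-subs₁⁺ (there v∈)  = there (∈-subs₁⁺ v∈)

∈-subs₂⁻ : ∀ c m {l} → l ∈ subs 2 (range c m) →
  ∃₂ λ u v → l ≡ u ∷ v ∷ [] × c ≤ u × u < v × v < c + m
∈-subs₂⁻ c (suc m) l∈ with ∈-++⁻ (map (c ∷_) (subs 1 (range (suc c) m))) l∈
... | inj₁ l∈c with map∷⁻ l∈c
... | _ , l′∈ , refl with ∈-subs₁⁻ (range (suc c) m) l′∈
... | v , refl , v∈ with ∈-range⁻ (suc c) m v∈
... | c<v , v<sc+m = c , v , refl , ≤-refl , c<v , subst (v <_) (sym (+-suc c m)) v<sc+m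
∈-subs₂⁻ c (suc m) l∈ | inj₂ l∈rest with ∈-subs₂⁻ (suc c) m l∈rest
... | u , v , refl , c<u , u<v , v<sc+m =
  u , v , refl , <⇒≤ c<u , u<v , subst (v <_) (sym (+-suc c m)) v<sc+m

∈-subs₂⁺ : ∀ c m {u v} → c ≤ u → u < v → v < c + m → (u ∷ v ∷ []) ∈ subs 2 (range c m)
∈-subs₂⁺ c zero    {u} {v} c≤u u<v v<c+0 =
  ⊥-elim (<-irrefl refl (<-≤-trans (subst (v <_) (+-identityʳ c) v<c+0) (≤-trans c≤u (<⇒≤ u<v))))
∈-subs₂⁺ c (suc m) {u} {v} c≤u u<v v<c+m with c ≟ u
... | yes refl =
  ∈-++⁺ˡ (∈-map⁺ (c ∷_) (∈-subs₁⁺ (∈-range⁺ (suc c) m u<v (subst (v <_) (+-suc c m) v<c+m))))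
... | no c≢u   = ∈-++⁺ʳ (map (c ∷_) (subs 1 (range (suc c) m)))
                   (∈-subs₂⁺ (suc c) m (≤∧≢⇒< c≤u c≢u) u<v (subst (v <_) (+-suc c m) v<c+m))

occurrence₂ : ∀ d X Y n π u v →
  occurrenceᵇ (pat (σ₂ d) X Y) n π (suc u ∷ suc v ∷ [])
    ≡ ordered d (nth π u) (nth π v)
        ∧ (adjᵇ n X (suc u ∷ suc v ∷ []) ∧ adjᵇ n Y (sort (nth π u ∷ nth π v ∷ [])))
occurrence₂ d X Y n π u v = cong (_∧ _) (orderIso-σ₂ d (nth π u) (nth π v))

contains₂⁻ : ∀ d X Y n π → length π ≡ n → T (containsᵇ (pat (σ₂ d) X Y) π) →
  ∃₂ λ u v → u < v × v < n × T (occurrenceᵇ (pat (σ₂ d) X Y) n π (suc u ∷ suc v ∷ []))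
contains₂⁻ d X Y n π refl t with find (any⁻ _ (subs 2 (oneTo (length π))) t)
... | l , l∈ , occ with ∈-subs₂⁻ 1 (length π) l∈
... | suc u , suc v , refl , _ , s≤s u<v , s≤s v<n = u , v , u<v , v<n , occ

contains₂⁺ : ∀ d X Y n π → length π ≡ n → ∀ u v → u < v → v < n →
  T (occurrenceᵇ (pat (σ₂ d) X Y) n π (suc u ∷ suc v ∷ [])) → T (containsᵇ (pat (σ₂ d) X Y) π)
contains₂⁺ d X Y n π refl u v u<v v<n occ =
  any⁺ _ (lose (∈-subs₂⁺ 1 (length π) (s≤s z≤n) (s≤s u<v) (s≤s v<n)) occ)

-- An adjacency set Z pins down a pair of 1-based entries: the only pair
-- (u , v) satisfying the adjacency requirement Z is (α+1 , β+1), with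
-- α < β < n.
record PinnedPair (n : ℕ) (Z : List ℕ) : Set where
  field
    α β      : ℕ
    α<β      : α < β
    β<n      : β < n
    pinned   : ∀ u v → T (adjᵇ n Z (u ∷ v ∷ [])) → u ≡ suc α × v ≡ suc β
    adjacent : T (adjᵇ n Z (suc α ∷ suc β ∷ []))

-- Z = {0,1}: the entries 1 and 2 (first two positions / two smallest values).
pinned01 : ∀ k → PinnedPair (suc (suc k)) (0 ∷ 1 ∷ [])
pinned01 k = record { α = 0 ; β = 1 ; α<β = s≤s z≤n ; β<n = s≤s (s≤s z≤n)
                    ; pinned = pin ; adjacent = tt }
  where
  pin : ∀ u v → T (adjᵇ (suc (suc k)) (0 ∷ 1 ∷ []) (u ∷ v ∷ [])) → u ≡ 1 × v ≡ 2
  pin u v t with T-∧⁻ (u ≡ᵇ 1) t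
  ... | u≡1 , rest with ≡ᵇ⇒≡ u 1 u≡1
  ... | refl = refl , ≡ᵇ⇒≡ v 2 (proj₁ (T-∧⁻ (v ≡ᵇ 2) rest))

-- Z = {1,2}: the entries n-1 and n (last two positions / two largest values).
pinned21 : ∀ k → PinnedPair (suc (suc k)) (2 ∷ 1 ∷ [])
pinned21 k = record { α = k ; β = suc k ; α<β = ≤-refl ; β<n = ≤-refl ; pinned = pin
                    ; adjacent = T-∧⁺ (≡ᵇ-T (suc (suc (suc k)))) (T-∧⁺ (≡ᵇ-T (suc (suc k))) tt) }
  where
  pin : ∀ u v → T (adjᵇ (suc (suc k)) (2 ∷ 1 ∷ []) (u ∷ v ∷ [])) → u ≡ suc k × v ≡ suc (suc k)
  pin u v t with T-∧⁻ (suc (suc (suc k)) ≡ᵇ suc v) t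
  ... | n+1≡1+v , rest with ≡ᵇ⇒≡ (suc (suc (suc k))) (suc v) n+1≡1+v
  ... | refl = suc-injective (sym (≡ᵇ⇒≡ v (suc u) (proj₁ (T-∧⁻ (v ≡ᵇ suc u) rest)))) , refl

-- Z = {0,2}: the entries 1 and n (first and last position / extreme values).
pinned02 : ∀ k → PinnedPair (suc (suc k)) (0 ∷ 2 ∷ [])
pinned02 k = record { α = 0 ; β = suc k ; α<β = s≤s z≤n ; β<n = ≤-refl ; pinned = pin
                    ; adjacent = T-∧⁺ (≡ᵇ-T (suc (suc (suc k)))) tt }
  where
  pin : ∀ u v → T (adjᵇ (suc (suc k)) (0 ∷ 2 ∷ []) (u ∷ v ∷ [])) → u ≡ 1 × v ≡ suc (suc k)
  pin u v t with T-∧⁻ (u ≡ᵇ 1) t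
  ... | u≡1 , rest =
    ≡ᵇ⇒≡ u 1 u≡1 , suc-injective (sym (≡ᵇ⇒≡ _ _ (proj₁ (T-∧⁻ (suc (suc (suc k)) ≡ᵇ suc v) rest))))

-- Z = {2,0}: the same entries, with the two requirements listed the other way.
pinned20 : ∀ k → PinnedPair (suc (suc k)) (2 ∷ 0 ∷ [])
pinned20 k = record { α = 0 ; β = suc k ; α<β = s≤s z≤n ; β<n = ≤-refl ; pinned = pin
                    ; adjacent = T-∧⁺ (≡ᵇ-T (suc (suc (suc k)))) tt }
  where
  pin : ∀ u v → T (adjᵇ (suc (suc k)) (2 ∷ 0 ∷ []) (u ∷ v ∷ [])) → u ≡ 1 × v ≡ suc (suc k)
  pin u v t with T-∧⁻ (suc (suc (suc k)) ≡ᵇ suc v) t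
  ... | n+1≡1+v , rest =
    ≡ᵇ⇒≡ u 1 (proj₁ (T-∧⁻ (u ≡ᵇ 1) rest)) , suc-injective (sym (≡ᵇ⇒≡ _ _ n+1≡1+v))

τ : ℕ → ℕ → ℕ → ℕ
τ a b k = if k ≡ᵇ a then b else (if k ≡ᵇ b then a else k)

τ-a : ∀ a b → τ a b a ≡ b
τ-a a b rewrite ≡ᵇ-refl a = refl

τ-b : ∀ a b → a ≢ b → τ a b b ≡ a
τ-b a b a≢b rewrite ≢⇒≡ᵇ-false (a≢b ∘ sym) | ≡ᵇ-refl b = refl

τ-other : ∀ a b k → k ≢ a → k ≢ b → τ a b k ≡ k
τ-other a b k k≢a k≢b rewrite ≢⇒≡ᵇ-false k≢a | ≢⇒≡ᵇ-false k≢b = refl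

τ-involutive : ∀ a b → a ≢ b → ∀ k → τ a b (τ a b k) ≡ k
τ-involutive a b a≢b k with k ≟ a | k ≟ b
... | yes refl | _        rewrite τ-a k b = τ-b k b a≢b
... | no _     | yes refl rewrite τ-b a k a≢b = τ-a a k
... | no k≢a   | no k≢b   rewrite τ-other a b k k≢a k≢b = τ-other a b k k≢a k≢b

τ-preserves : ∀ (P : ℕ → Set) a b k → P a → P b → P k → P (τ a b k)
τ-preserves P a b k pa pb pk with k ≡ᵇ a
... | true  = pb
... | false with k ≡ᵇ b
... | true  = pa
... | false = pk

nth-∈ : ∀ xs {i} → i < length xs → nth xs i ∈ xs
nth-∈ (x ∷ xs) {zero}  _         = here refl
nth-∈ (x ∷ xs) {suc i} (s≤s i<n) = there (nth-∈ xs i<n)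

∈⇒nth : ∀ xs {v} → v ∈ xs → ∃ λ i → i < length xs × nth xs i ≡ v
∈⇒nth (x ∷ xs) (here refl) = 0 , s≤s z≤n , refl
∈⇒nth (x ∷ xs) (there v∈) with ∈⇒nth xs v∈
... | i , i<n , refl = suc i , s≤s i<n , refl

nth-injective : ∀ xs → Unique xs → ∀ {i j} → i < length xs → j < length xs →
  nth xs i ≡ nth xs j → i ≡ j
nth-injective (x ∷ xs) _         {zero}  {zero}  _         _         _ = refl
nth-injective (x ∷ xs) (x≢ ∷ _)  {zero}  {suc j} _         (s≤s j<n) e =
  ⊥-elim (All¬⇒¬Any x≢ (subst (_∈ xs) (sym e) (nth-∈ xs j<n)))
nth-injective (x ∷ xs) (x≢ ∷ _)  {suc i} {zero}  (s≤s i<n) _         e =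
  ⊥-elim (All¬⇒¬Any x≢ (subst (_∈ xs) e (nth-∈ xs i<n)))
nth-injective (x ∷ xs) (_ ∷ xs!) {suc i} {suc j} (s≤s i<n) (s≤s j<n) e =
  cong suc (nth-injective xs xs! i<n j<n e)

nth-ext : ∀ (xs ys : List ℕ) → length xs ≡ length ys →
  (∀ k → k < length xs → nth xs k ≡ nth ys k) → xs ≡ ys
nth-ext []       []       _   _ = refl
nth-ext (x ∷ xs) (y ∷ ys) len h =
  cong₂ _∷_ (h 0 (s≤s z≤n)) (nth-ext xs ys (suc-injective len) (λ k k<n → h (suc k) (s≤s k<n)))

-- Exchanging the entries at the (0-based) positions i and j.
swapPositions : ℕ → ℕ → List ℕ → List ℕ
swapPositions i j π = map (λ k → nth π (τ i j k)) (range 0 (length π))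

length-swapPositions : ∀ i j π → length (swapPositions i j π) ≡ length π
length-swapPositions i j π = trans (length-map _ (range 0 (length π))) (length-range 0 (length π))

module SwapPositions (i j : ℕ) (i≢j : i ≢ j) (π : List ℕ)
                     (i<n : i < length π) (j<n : j < length π) where

  length-swap : length (swapPositions i j π) ≡ length π
  length-swap = length-swapPositions i j π

  τ<n : ∀ {k} → k < length π → τ i j k < length π
  τ<n {k} = τ-preserves (_< length π) i j k i<n j<n

  nth-swap : ∀ {k} → k < length π → nth (swapPositions i j π) k ≡ nth π (τ i j k)
  nth-swap = nth-map-range (λ k → nth π (τ i j k)) 0 (length π)

  swap-involutive : swapPositions i j (swapPositions i j π) ≡ π
  swap-involutive =
    nth-ext _ π (trans (length-swapPositions i j (swapPositions i j π)) length-swap) entries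
    where
    entries : ∀ k → k < length (swapPositions i j (swapPositions i j π)) →
      nth (swapPositions i j (swapPositions i j π)) k ≡ nth π k
    entries k k<n′ = begin
      nth (swapPositions i j (swapPositions i j π)) k ≡⟨ nth-map-range _ 0 _ k<n″ ⟩
      nth (swapPositions i j π) (τ i j k)              ≡⟨ nth-swap (τ<n k<n) ⟩
      nth π (τ i j (τ i j k))                          ≡⟨ cong (nth π) (τ-involutive i j i≢j k) ⟩
      nth π k                                          ∎
      where
      open ≡-Reasoning
      k<n″ : k < length (swapPositions i j π)
      k<n″ = subst (k <_) (length-swapPositions i j (swapPositions i j π)) k<n′
      k<n : k < length π
      k<n = subst (k <_) length-swap k<n″

  swap-⊆ : swapPositions i j π ⊆ π
  swap-⊆ v∈ with ∈⇒nth _ v∈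
  ... | k , k<n′ , refl = subst (_∈ π) (sym (nth-swap k<n)) (nth-∈ π (τ<n k<n))
    where
    k<n : k < length π
    k<n = subst (k <_) length-swap k<n′

  ⊆-swap : π ⊆ swapPositions i j π
  ⊆-swap v∈ with ∈⇒nth π v∈
  ... | k , k<n , refl =
    subst (_∈ swapPositions i j π) entry (nth-∈ _ (subst (τ i j k <_) (sym length-swap) (τ<n k<n)))
    where
    entry : nth (swapPositions i j π) (τ i j k) ≡ nth π k
    entry = trans (nth-swap (τ<n k<n)) (cong (nth π) (τ-involutive i j i≢j k))

-- Position patterns (σ₂ d , Z , ∅): containment only concerns the entries
-- at the two pinned positions α < β, and exchanging them toggles it.
module PositionPattern (d : Bool) (Z : List ℕ) (n : ℕ) (pp : PinnedPair n Z) where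
  open PinnedPair pp

  P : Pattern
  P = pat (σ₂ d) Z []

  contains⇔ : ∀ π → T (IsPermOfᵇ n π) → containsᵇ P π ≡ ordered d (nth π α) (nth π β)
  contains⇔ π t = T-ext to from
    where
    len : length π ≡ n
    len = proj₁ (isPerm⇒ n π t)
    to : T (containsᵇ P π) → T (ordered d (nth π α) (nth π β))
    to c with contains₂⁻ d Z [] n π len c
    ... | u , v , _ , _ , occ
          with T-∧⁻ (ordered d (nth π u) (nth π v)) (subst T (occurrence₂ d Z [] n π u v) occ)
    ... | ord , adj with pinned (suc u) (suc v) (proj₁ (T-∧⁻ (adjᵇ n Z (suc u ∷ suc v ∷ [])) adj))
    ... | refl , refl = ord
    from : T (ordered d (nth π α) (nth π β)) → T (containsᵇ P π)
    from ord = contains₂⁺ d Z [] n π len α β α<β β<n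
      (subst T (sym (occurrence₂ d Z [] n π α β)) (T-∧⁺ ord (T-∧⁺ adjacent tt)))

  halves : a n P ≡ n ! / 2
  halves = halving P n (swapPositions α β) closed involutive toggles
    where
    α≢β : α ≢ β
    α≢β = <⇒≢ α<β
    β<len : ∀ π → T (IsPermOfᵇ n π) → β < length π
    β<len π t = subst (β <_) (sym (proj₁ (isPerm⇒ n π t))) β<n
    α<len : ∀ π → T (IsPermOfᵇ n π) → α < length π
    α<len π t = <-trans α<β (β<len π t)
    module Swap π (t : T (IsPermOfᵇ n π)) = SwapPositions α β α≢β π (α<len π t) (β<len π t)
    closed : ∀ π → T (IsPermOfᵇ n π) → T (IsPermOfᵇ n (swapPositions α β π))
    closed π t with isPerm⇒ n π t
    ... | len , into , onto =
      isPerm⇐ n _ (trans (Swap.length-swap π t) len) (into ∘ Swap.swap-⊆ π t) (Swap.⊆-swap π t ∘ onto)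
    involutive : ∀ π → T (IsPermOfᵇ n π) → swapPositions α β (swapPositions α β π) ≡ π
    involutive π t = Swap.swap-involutive π t
    toggles : ∀ π → T (IsPermOfᵇ n π) → containsᵇ P (swapPositions α β π) ≡ not (containsᵇ P π)
    toggles π t = begin
      containsᵇ P π′                          ≡⟨ contains⇔ π′ (closed π t) ⟩
      ordered d (nth π′ α) (nth π′ β)         ≡⟨ cong₂ (ordered d) (moved α β (τ-a α β) (α<len π t))
                                                                   (moved β α (τ-b α β α≢β) (β<len π t)) ⟩
      ordered d (nth π β) (nth π α)           ≡⟨ ordered-flip d (nth π α) (nth π β) distinct ⟩
      not (ordered d (nth π α) (nth π β))     ≡⟨ cong not (sym (contains⇔ π t)) ⟩
      not (containsᵇ P π)                     ∎
      where
      open ≡-Reasoning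
      π′ : List ℕ
      π′ = swapPositions α β π
      moved : ∀ i j → τ α β i ≡ j → i < length π → nth π′ i ≡ nth π j
      moved i j τi≡j i<n = trans (Swap.nth-swap π t i<n) (cong (nth π) τi≡j)
      distinct : nth π α ≢ nth π β
      distinct e = α≢β (nth-injective π (perm-unique n π t) (α<len π t) (β<len π t) e)

indexOf : ℕ → List ℕ → ℕ
indexOf v []       = 0
indexOf v (x ∷ xs) = if v ≡ᵇ x then 0 else suc (indexOf v xs)

indexOf-nth : ∀ {v} xs → v ∈ xs → indexOf v xs < length xs × nth xs (indexOf v xs) ≡ v
indexOf-nth {v} (x ∷ xs) v∈ with v ≟ x | v∈
... | yes refl | _          rewrite ≡ᵇ-refl v = s≤s z≤n , refl
... | no v≢x   | here v≡x   = ⊥-elim (v≢x v≡x)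
... | no v≢x   | there v∈xs rewrite ≢⇒≡ᵇ-false v≢x with indexOf-nth xs v∈xs
...   | i<n , entry = s≤s i<n , entry

indexOf-least : ∀ {v} xs i → nth xs i ≡ v → indexOf v xs ≤ i
indexOf-least []       i       _     = z≤n
indexOf-least (x ∷ xs) zero    refl rewrite ≡ᵇ-refl x = z≤n
indexOf-least {v} (x ∷ xs) (suc i) entry with v ≡ᵇ x
... | true  = z≤n
... | false = s≤s (indexOf-least xs i entry)

indexOf-< : ∀ xs → Unique xs → ∀ {u v a b} → u < v → v < length xs →
  nth xs u ≡ a → nth xs v ≡ b → indexOf a xs < indexOf b xs
indexOf-< xs xs! {u} {v} {b = b} u<v v<n refl refl =
  ≤-<-trans (indexOf-least xs u refl) (subst (u <_) (sym index-b) u<v)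
  where
  index-b : indexOf b xs ≡ v
  index-b = nth-injective xs xs! (proj₁ first) v<n (proj₂ first)
    where
    first : indexOf b xs < length xs × nth xs (indexOf b xs) ≡ b
    first = indexOf-nth xs (nth-∈ xs v<n)

≡ᵇ-involution : ∀ (s : ℕ → ℕ) → (∀ x → s (s x) ≡ x) → ∀ v x → (v ≡ᵇ s x) ≡ (s v ≡ᵇ x)
≡ᵇ-involution s invol v x =
  T-ext (λ t → ≡⇒≡ᵇ _ _ (trans (cong s (≡ᵇ⇒≡ _ _ t)) (invol x)))
        (λ t → ≡⇒≡ᵇ _ _ (trans (sym (invol v)) (cong s (≡ᵇ⇒≡ _ _ t))))

indexOf-map : ∀ (s : ℕ → ℕ) → (∀ x → s (s x) ≡ x) → ∀ v xs → indexOf v (map s xs) ≡ indexOf (s v) xs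
indexOf-map s invol v []       = refl
indexOf-map s invol v (x ∷ xs) rewrite ≡ᵇ-involution s invol v x with s v ≡ᵇ x
... | true  = refl
... | false = cong suc (indexOf-map s invol v xs)

sort-pair : ∀ d x y → T (ordered d x y) → sort (x ∷ y ∷ []) ≡ (if d then x ∷ y ∷ [] else y ∷ x ∷ [])
sort-pair true  x y x<y rewrite T-≡ x<y = refl
sort-pair false x y y<x with x <ᵇ y in x<y
... | true  = ⊥-elim (<ᵇ-asym {x} {y} x<y (T-≡ y<x))
... | false = refl

swapValues : ℕ → ℕ → List ℕ → List ℕ
swapValues a b = map (τ a b)

swapValues-involutive : ∀ a b → a ≢ b → ∀ π → swapValues a b (swapValues a b π) ≡ π
swapValues-involutive a b a≢b π = begin
  map (τ a b) (map (τ a b) π)   ≡⟨ sym (map-∘ π) ⟩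
  map (τ a b ∘ τ a b) π         ≡⟨ map-cong (τ-involutive a b a≢b) π ⟩
  map id π                      ≡⟨ map-id π ⟩
  π                             ∎
  where open ≡-Reasoning

-- Value patterns (σ₂ d , ∅ , Z): containment only concerns the relative
-- position of the two pinned values A = α+1 < B = β+1, and exchanging these
-- values toggles it.
module ValuePattern (d : Bool) (Z : List ℕ) (n : ℕ) (pp : PinnedPair n Z) where
  open PinnedPair pp

  P : Pattern
  P = pat (σ₂ d) [] Z

  A B : ℕ
  A = suc α
  B = suc β

  A<B : A < B
  A<B = s≤s α<β

  A∈ : A ∈ oneTo n
  A∈ = ∈-oneTo⁺ n (s≤s z≤n) (<-trans α<β β<n)

  B∈ : B ∈ oneTo n
  B∈ = ∈-oneTo⁺ n (s≤s z≤n) β<n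

  E : List ℕ → Bool
  E π = ordered d (indexOf A π) (indexOf B π)

  -- The two directions analyse the order d of σ₂ d; the module parameter d
  -- is split through an equation d ≡ d′.
  contains⇔ : ∀ π → T (IsPermOfᵇ n π) → containsᵇ P π ≡ E π
  contains⇔ π t = T-ext to (from d refl)
    where
    len : length π ≡ n
    len = proj₁ (isPerm⇒ n π t)
    π! : Unique π
    π! = perm-unique n π t
    to : T (containsᵇ P π) → T (E π)
    to c with contains₂⁻ d [] Z n π len c
    ... | u , v , u<v , v<n , occ
          with T-∧⁻ (ordered d (nth π u) (nth π v)) (subst T (occurrence₂ d [] Z n π u v) occ)
    ... | ord , adj = by-order d refl ord adj
      where
      v<len : v < length π
      v<len = subst (v <_) (sym len) v<n
      -- the adjacency requirement identifies the two values
      by-order : ∀ d′ → d ≡ d′ → T (ordered d′ (nth π u) (nth π v)) →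
        T (adjᵇ n Z (sort (nth π u ∷ nth π v ∷ []))) → T (E π)
      by-order true  refl ord adj with pinned _ _ (subst (T ∘ adjᵇ n Z) (sort-pair true _ _ ord) adj)
      ... | x≡A , y≡B = <⇒<ᵇ (indexOf-< π π! u<v v<len x≡A y≡B)
      by-order false refl ord adj with pinned _ _ (subst (T ∘ adjᵇ n Z) (sort-pair false _ _ ord) adj)
      ... | y≡A , x≡B = <⇒<ᵇ (indexOf-< π π! u<v v<len x≡B y≡A)
    occurs : ∀ p q x y → p < q → q < n → nth π p ≡ x → nth π q ≡ y → T (ordered d x y) →
      sort (x ∷ y ∷ []) ≡ A ∷ B ∷ [] → T (containsᵇ P π)
    occurs p q x y p<q q<n refl refl ord sorted = contains₂⁺ d [] Z n π len p q p<q q<n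
      (subst T (sym (occurrence₂ d [] Z n π p q))
        (T-∧⁺ ord (subst (T ∘ adjᵇ n Z) (sym sorted) adjacent)))
    iA : indexOf A π < length π × nth π (indexOf A π) ≡ A
    iA = indexOf-nth π (proj₂ (proj₂ (isPerm⇒ n π t)) A∈)
    iB : indexOf B π < length π × nth π (indexOf B π) ≡ B
    iB = indexOf-nth π (proj₂ (proj₂ (isPerm⇒ n π t)) B∈)
    A<ᵇB : T (A <ᵇ B)
    A<ᵇB = <⇒<ᵇ A<B
    -- the occurrence sits at the positions of A and B, taken in increasing order
    from : ∀ d′ → d ≡ d′ → T (E π) → T (containsᵇ P π)
    from true  refl e = occurs (indexOf A π) (indexOf B π) A B (<ᵇ⇒< _ _ e)
                          (subst (indexOf B π <_) len (proj₁ iB)) (proj₂ iA) (proj₂ iB)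
                          A<ᵇB (sort-pair true A B A<ᵇB)
    from false refl e = occurs (indexOf B π) (indexOf A π) B A (<ᵇ⇒< _ _ e)
                          (subst (indexOf A π <_) len (proj₁ iA)) (proj₂ iB) (proj₂ iA)
                          A<ᵇB (sort-pair false B A A<ᵇB)

  halves : a n P ≡ n ! / 2
  halves = halving P n (swapValues A B) closed (λ π _ → swapValues-involutive A B A≢B π) toggles
    where
    A≢B : A ≢ B
    A≢B = <⇒≢ A<B
    τ-invol : ∀ k → τ A B (τ A B k) ≡ k
    τ-invol = τ-involutive A B A≢B
    closed : ∀ π → T (IsPermOfᵇ n π) → T (IsPermOfᵇ n (swapValues A B π))
    closed π t with isPerm⇒ n π t
    ... | len , into , onto = isPerm⇐ n _ (trans (length-map _ π) len) into′ onto′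
      where
      into′ : swapValues A B π ⊆ oneTo n
      into′ v∈ with ∈-map⁻ (τ A B) v∈
      ... | w , w∈ , refl = τ-preserves (_∈ oneTo n) A B w A∈ B∈ (into w∈)
      onto′ : oneTo n ⊆ swapValues A B π
      onto′ {m} m∈ = subst (_∈ swapValues A B π) (τ-invol m)
                       (∈-map⁺ (τ A B) (onto (τ-preserves (_∈ oneTo n) A B m A∈ B∈ m∈)))
    toggles : ∀ π → T (IsPermOfᵇ n π) → containsᵇ P (swapValues A B π) ≡ not (containsᵇ P π)
    toggles π t = begin
      containsᵇ P π′                           ≡⟨ contains⇔ π′ (closed π t) ⟩
      ordered d (indexOf A π′) (indexOf B π′)  ≡⟨ cong₂ (ordered d) (moved A B (τ-a A B))
                                                                    (moved B A (τ-b A B A≢B)) ⟩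
      ordered d (indexOf B π) (indexOf A π)    ≡⟨ ordered-flip d _ _ distinct ⟩
      not (E π)                                ≡⟨ cong not (sym (contains⇔ π t)) ⟩
      not (containsᵇ P π)                      ∎
      where
      open ≡-Reasoning
      π′ : List ℕ
      π′ = swapValues A B π
      moved : ∀ v w → τ A B v ≡ w → indexOf v π′ ≡ indexOf w π
      moved v w τv≡w = trans (indexOf-map (τ A B) τ-invol v π) (cong (λ x → indexOf x π) τv≡w)
      onto : oneTo n ⊆ π
      onto = proj₂ (proj₂ (isPerm⇒ n π t))
      distinct : indexOf A π ≢ indexOf B π
      distinct e = A≢B (trans (sym (proj₂ (indexOf-nth π (onto A∈))))
                         (trans (cong (nth π) e) (proj₂ (indexOf-nth π (onto B∈)))))

-- Decidable equality of patterns, used to let Agda verify closure of a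
-- finite list of patterns under the symmetries by computation.
_≟ₚ_ : (p q : Pattern) → Dec (p ≡ q)
pat s x y ≟ₚ pat s′ x′ y′ with ≡-dec _≟_ s s′ | ≡-dec _≟_ x x′ | ≡-dec _≟_ y y′
... | yes refl | yes refl | yes refl = yes refl
... | no s≢s′  | _        | _        = no λ { refl → s≢s′ refl }
... | yes _    | no x≢x′  | _        = no λ { refl → x≢x′ refl }
... | yes _    | yes _    | no y≢y′  = no λ { refl → y≢y′ refl }

ClosedUnder : (Pattern → Pattern) → List Pattern → Set
ClosedUnder f S = All (λ q → f q ∈ S) S

closedUnder? : ∀ f S → Dec (ClosedUnder f S)
closedUnder? f S = all? (λ q → Any.any? (f q ≟ₚ_) S) S

class⊆ : ∀ {p} S → p ∈ S → ClosedUnder symI S → ClosedUnder symR S → ClosedUnder symC S →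
  ∀ {q} → InClass p q → q ∈ S
class⊆ S p∈ cI cR cC base     = p∈
class⊆ S p∈ cI cR cC (viaI c) = lookup cI (class⊆ S p∈ cI cR cC c)
class⊆ S p∈ cI cR cC (viaR c) = lookup cR (class⊆ S p∈ cI cR cC c)
class⊆ S p∈ cI cR cC (viaC c) = lookup cC (class⊆ S p∈ cI cR cC c)

orbit : List ℕ → List ℕ → List Pattern
orbit z w =
  pat (σ₂ true)  [] z ∷ pat (σ₂ true)  [] w ∷ pat (σ₂ true)  z [] ∷ pat (σ₂ true)  w [] ∷
  pat (σ₂ false) [] z ∷ pat (σ₂ false) [] w ∷ pat (σ₂ false) z [] ∷ pat (σ₂ false) w [] ∷ []

orbit-halves : ∀ {z w n} → PinnedPair n z → PinnedPair n w → All (λ q → a n q ≡ n ! / 2) (orbit z w)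
orbit-halves {z} {w} {n} pz pw =
  ValuePattern.halves true z n pz ∷ ValuePattern.halves true w n pw ∷
  PositionPattern.halves true z n pz ∷ PositionPattern.halves true w n pw ∷
  ValuePattern.halves false z n pz ∷ ValuePattern.halves false w n pw ∷
  PositionPattern.halves false z n pz ∷ PositionPattern.halves false w n pw ∷ []

-- The symmetry class of (12, ∅, {0,1}) is the orbit of {0,1} and {1,2};
-- that of (12, ∅, {0,2}) is the orbit of {0,2} (listed both ways round).
class01 class02 : List Pattern
class01 = orbit (0 ∷ 1 ∷ []) (2 ∷ 1 ∷ [])
class02 = orbit (0 ∷ 2 ∷ []) (2 ∷ 0 ∷ [])

in-class01 : ∀ {q} → InClass (pat (1 ∷ 2 ∷ []) [] (0 ∷ 1 ∷ [])) q → q ∈ class01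
in-class01 = class⊆ class01 (here refl)
  (toWitness {a? = closedUnder? symI class01} tt)
  (toWitness {a? = closedUnder? symR class01} tt)
  (toWitness {a? = closedUnder? symC class01} tt)

in-class02 : ∀ {q} → InClass (pat (1 ∷ 2 ∷ []) [] (0 ∷ 2 ∷ [])) q → q ∈ class02
in-class02 = class⊆ class02 (here refl)
  (toWitness {a? = closedUnder? symI class02} tt)
  (toWitness {a? = closedUnder? symR class02} tt)
  (toWitness {a? = closedUnder? symC class02} tt)

-- For n ≥ 2 the pinned pairs exist; p lies in one of the two orbits.
mainTheorem3 : (p : Pattern) →
    (InClass (pat (1 ∷ 2 ∷ []) [] (0 ∷ 1 ∷ [])) p ⊎ InClass (pat (1 ∷ 2 ∷ []) [] (0 ∷ 2 ∷ [])) p) →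
    (n : ℕ) → 2 ≤ n → a n p ≡ (n !) / 2
mainTheorem3 p (inj₁ c) (suc (suc k)) (s≤s (s≤s z≤n)) =
  lookup (orbit-halves (pinned01 k) (pinned21 k)) (in-class01 c)
mainTheorem3 p (inj₂ c) (suc (suc k)) (s≤s (s≤s z≤n)) =
  lookup (orbit-halves (pinned02 k) (pinned20 k)) (in-class02 c)
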